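{- Let $n$ be an even integer ($n\ge 4$), let $B=\{v\in V(C_n\square K_2): x_v+y_v\equiv 1\pmod 2\}$ and $A=V(C_n\square K_2)\setminus B$. If $v,w\in A$ satisfy $d_{C_n}(x_v,x_w)\equiv 0\pmod 2$, then there exists $s\in B$ such that $d(v,s)=d(w,s)$.
   Context: $C_n$ is the cycle with vertex set $[n]=\{1,\dots,n\}$, where $i$ is adjacent to $i+1$ for $1\le i<n$ and $n$ is adjacent to $1$; $K_2$ has vertex set $\{1,2\}$. The Cartesian product $C_n\square K_2$ has vertex set $[n]\times\{1,2\}$, with $(g,h)\sim(g',h')$ iff either $g=g'$ and $hh'$ is an edge of $K_2$, or $h=h'$ and $gg'\in E(C_n)$. A vertex $v$ is written $v=(x_v,y_v)$. $d$ denotes the shortest-path distance in $C_n\square K_2$ (so $d(v,w)=d_{C_n}(x_v,x_w)+d_{K_2}(y_v,y_w)$). -}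

module Defs where

open import Data.Nat using (ℕ; _+_; _∸_; _≤_; _⊓_; _%_; _≡ᵇ_)
open import Data.Nat.Properties using ()
open import Data.Product using (_×_; _,_; proj₁; proj₂)
open import Relation.Binary.PropositionalEquality using (_≡_)
open import Data.Sum using (_⊎_)

absDiff : ℕ → ℕ → ℕ
absDiff a b = (a ∸ b) + (b ∸ a)

Vertex : Set
Vertex = ℕ × ℕ

x : Vertex → ℕ
x = proj₁

y : Vertex → ℕ
y = proj₂

IsVertex : ℕ → Vertex → Set
IsVertex n v = (1 ≤ x v × x v ≤ n) × (y v ≡ 1 ⊎ y v ≡ 2)

dC : ℕ → ℕ → ℕ → ℕ
dC n a b = absDiff a b ⊓ (n ∸ absDiff a b)

dK2 : ℕ → ℕ → ℕ
dK2 a b = absDiff a b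

dist : ℕ → Vertex → Vertex → ℕ
dist n v w = dC n (x v) (x w) + dK2 (y v) (y w)

InB : Vertex → Set
InB v = (x v + y v) % 2 ≡ 1

InA : Vertex → Set
InA v = (x v + y v) % 2 ≡ 0

module Submission where

open import Defs
open import Data.Nat using (ℕ; zero; suc; _+_; _*_; _∸_; _⊓_; _%_; _≤_)
open import Data.Nat.Properties
  using (+-comm; +-assoc; +-identityʳ; *-comm; ⊓-sel; m+[n∸m]≡n; m≤n⇒m∸n≡0; m+n∸m≡n; m≤m+n; m≤n+m;
         +-monoʳ-≤; ≤-trans; ≤-total; m≤n⇒∃[o]m+o≡n)
open import Data.Nat.Divisibility using (_∣_; divides; ∣m+n∣m⇒∣n; m%n≡0⇒n∣m)
open import Data.Nat.DivMod using (%-remove-+ʳ)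
open import Data.Product using (_×_; Σ; ∃; _,_)
open import Data.Sum using (_⊎_; inj₁; inj₂; [_,_]′)
open import Data.Empty using (⊥; ⊥-elim)
open import Relation.Binary.PropositionalEquality using (_≡_; refl; sym; trans; cong; subst)
open Relation.Binary.PropositionalEquality.≡-Reasoning

-- Proof idea: we may assume x_v ≤ x_w. As n is even, d_{C_n}(x_v, x_w) has the parity of
-- x_w − x_v, so this difference is even; since v and w both lie in A they then lie on the
-- same level of the prism. The column halfway between x_v and x_w is equidistant from both in
-- the cycle, and one of its two vertices lies in B; the K_2 contribution is the same for v and w.

Level : ℕ → Set
Level t = t ≡ 1 ⊎ t ≡ 2

EquidistantBVertex : ℕ → Vertex → Vertex → Set
EquidistantBVertex n v w = Σ Vertex (λ s → IsVertex n s × InB s × dist n v s ≡ dist n w s)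

absDiff-comm : ∀ a b → absDiff a b ≡ absDiff b a
absDiff-comm a b = +-comm (a ∸ b) (b ∸ a)

absDiff-+ʳ : ∀ a k → absDiff a (a + k) ≡ k
absDiff-+ʳ a k rewrite m≤n⇒m∸n≡0 (m≤m+n a k) | m+n∸m≡n a k = refl

absDiff-+ˡ : ∀ a k → absDiff (a + k) a ≡ k
absDiff-+ˡ a k = trans (absDiff-comm (a + k) a) (absDiff-+ʳ a k)

dC-comm : ∀ n a b → dC n a b ≡ dC n b a
dC-comm n a b rewrite absDiff-comm a b = refl

∣n∣n∸m⇒∣m : ∀ {d m n} → m ≤ n → d ∣ n → d ∣ n ∸ m → d ∣ m
∣n∣n∸m⇒∣m {d} {m} {n} m≤n d∣n d∣n∸m =
  ∣m+n∣m⇒∣n (subst (d ∣_) (trans (sym (m+[n∸m]≡n m≤n)) (+-comm m (n ∸ m))) d∣n) d∣n∸m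

even-cycleDistance⇒even : ∀ {n D} → 2 ∣ n → D ≤ n → 2 ∣ D ⊓ (n ∸ D) → 2 ∣ D
even-cycleDistance⇒even {n} {D} 2∣n D≤n 2∣min with ⊓-sel D (n ∸ D)
... | inj₁ min≡D = subst (2 ∣_) min≡D 2∣min
... | inj₂ min≡n∸D = ∣n∣n∸m⇒∣m D≤n 2∣n (subst (2 ∣_) min≡n∸D 2∣min)

even⇒double : ∀ {D} → 2 ∣ D → ∃ λ k → D ≡ k + k
even⇒double {D} (divides k D≡k*2) = k , (begin
  D           ≡⟨ D≡k*2 ⟩
  k * 2       ≡⟨ *-comm k 2 ⟩
  k + (k + 0) ≡⟨ cong (k +_) (+-identityʳ k) ⟩
  k + k       ∎)

¬even-both : ∀ a → (a + 1) % 2 ≡ 0 → (a + 2) % 2 ≡ 0 → ⊥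
¬even-both zero ()
¬even-both (suc zero) _ ()
¬even-both (suc (suc a)) = ¬even-both a

even-levels-equal : ∀ a {u w} → Level u → Level w → (a + u) % 2 ≡ 0 → (a + w) % 2 ≡ 0 → u ≡ w
even-levels-equal a (inj₁ refl) (inj₁ refl) _ _ = refl
even-levels-equal a (inj₂ refl) (inj₂ refl) _ _ = refl
even-levels-equal a (inj₁ refl) (inj₂ refl) even₁ even₂ = ⊥-elim (¬even-both a even₁ even₂)
even-levels-equal a (inj₂ refl) (inj₁ refl) even₂ even₁ = ⊥-elim (¬even-both a even₁ even₂)

odd-level : ∀ c → Σ ℕ λ t → Level t × (c + t) % 2 ≡ 1
odd-level zero = 1 , inj₁ refl , refl
odd-level (suc zero) = 2 , inj₂ refl , refl
odd-level (suc (suc c)) = odd-level c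

+-even-%2 : ∀ a D w → 2 ∣ D → (a + D + w) % 2 ≡ (a + w) % 2
+-even-%2 a D w 2∣D = begin
  (a + D + w) % 2   ≡⟨ cong (_% 2) (+-assoc a D w) ⟩
  (a + (D + w)) % 2 ≡⟨ cong (λ m → (a + m) % 2) (+-comm D w) ⟩
  (a + (w + D)) % 2 ≡⟨ cong (_% 2) (sym (+-assoc a w D)) ⟩
  (a + w + D) % 2   ≡⟨ %-remove-+ʳ (a + w) 2∣D ⟩
  (a + w) % 2       ∎

midpoint-in-B : ∀ n a k u → 1 ≤ a → a + (k + k) ≤ n →
  EquidistantBVertex n (a , u) (a + (k + k) , u)
midpoint-in-B n a k u 1≤a b≤n with odd-level (a + k)
... | t , t-level , odd = (a + k , t) , ((1≤a+k , a+k≤n) , t-level) , odd , cong (_+ dK2 u t) equidistant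
  where
  1≤a+k : 1 ≤ a + k
  1≤a+k = ≤-trans 1≤a (m≤m+n a k)
  a+k≤n : a + k ≤ n
  a+k≤n = ≤-trans (+-monoʳ-≤ a (m≤m+n k k)) b≤n
  equidistant : dC n a (a + k) ≡ dC n (a + (k + k)) (a + k)
  equidistant rewrite sym (+-assoc a k k) | absDiff-+ʳ a k | absDiff-+ˡ (a + k) k = refl

equidistant-B-vertex-≤ : ∀ n → 2 ∣ n → (v w : Vertex) → IsVertex n v → IsVertex n w → InA v → InA w →
  2 ∣ dC n (x v) (x w) → x v ≤ x w →
  EquidistantBVertex n v w
equidistant-B-vertex-≤ n 2∣n (a , u) (b , w) ((1≤a , _) , u-level) ((_ , b≤n) , w-level) vA wA 2∣d a≤b
  with m≤n⇒∃[o]m+o≡n a≤b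
... | D , refl
  with even-cycleDistance⇒even 2∣n (≤-trans (m≤n+m D a) b≤n) (subst (λ e → 2 ∣ e ⊓ (n ∸ e)) (absDiff-+ʳ a D) 2∣d)
... | 2∣D with even-levels-equal a u-level w-level vA (trans (sym (+-even-%2 a D w 2∣D)) wA)
... | refl with even⇒double 2∣D
... | k , refl = midpoint-in-B n a k u 1≤a b≤n

mainTheorem11 : (n : ℕ) → n % 2 ≡ 0 → 4 ≤ n →
    (v w : Vertex) → IsVertex n v → IsVertex n w → InA v → InA w →
    dC n (x v) (x w) % 2 ≡ 0 →
    Σ Vertex (λ s → IsVertex n s × InB s × dist n v s ≡ dist n w s)
mainTheorem11 n n-even _ v w vV wV vA wA d-even = [ from-≤ , from-≥ ]′ (≤-total (x v) (x w))
  where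
  2∣n : 2 ∣ n
  2∣n = m%n≡0⇒n∣m n 2 n-even
  2∣d : 2 ∣ dC n (x v) (x w)
  2∣d = m%n≡0⇒n∣m _ 2 d-even
  from-≤ : x v ≤ x w → EquidistantBVertex n v w
  from-≤ = equidistant-B-vertex-≤ n 2∣n v w vV wV vA wA 2∣d
  from-≥ : x w ≤ x v → EquidistantBVertex n v w
  from-≥ xw≤xv with equidistant-B-vertex-≤ n 2∣n w v wV vV wA vA (subst (2 ∣_) (dC-comm n (x v) (x w)) 2∣d) xw≤xv
  ... | s , sV , sB , ds = s , sV , sB , sym ds
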